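{- Let $Q=(F,+,\circ)$ be a presemifield whose transpose $Q^t=(F,+,\star)$ is commutative. Let $G(z)=z\star z$ and define $f:F\times F\to\mathbb{F}_2$ by $f(0,y)=0$ and, for $x\neq0$, $f(x,y)=tr(G(z)x)$ where $z$ is the unique element with $x\circ z=y$. Then $f$ is bent, $\mathcal{O}=\{x=0\}\cup\{y=z\star z+x\star z:z\in F\}$ is a line oval in $\mathcal{A}(Q^t)$, and the dual of $f$ is $\tilde f(x,y)=1+\chi_{E(\mathcal{O})}(y,x)$, i.e. $\tilde f(x,y)=0$ if $(y,x)\in E(\mathcal{O})$ and $1$ otherwise.
   Context: Let $m\ge1$, $q=2^m$, $F=\mathbb{F}_q$, $tr$ the absolute trace $F\to\mathbb{F}_2$. A presemifield $Q=(F,+,\circ)$ is $F$ with its field addition and a multiplication $\circ$ such that $(F\setminus\{0\},\circ)$ is a quasigroup, both distributive laws $(x+y)\circ z=x\circ z+y\circ z$ and $z\circ(x+y)=z\circ x+z\circ y$ hold, and $x\circ0=0$. Its transpose $Q^t=(F,+,\star)$ is defined by $tr((x\star z)y)=tr(x(y\circ z))$ for all $x,y,z$. $\mathcal{A}(Q^t)$: points $F\times F$, lines $x=c$ and $y=x\star b+a$ ($a,b,c\in F$). A line oval in $\mathcal{A}(Q^t)$ is a set of $q+1$ lines, no two parallel, no three through a common point. $E(\mathcal{O})$ is the set of points on at least one line of $\mathcal{O}$. Bent: $\sum_{x,y}(-1)^{f(x,y)+tr(ax+by)}=\pm q$ for all $a,b$; dual: $W_f(a,b)=(-1)^{\tilde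 f(a,b)}q$. -}

module Defs where

open import Level using (Level; suc; zero)
open import Data.Nat using (ℕ; _^_; _≥_)
import Data.Nat as ℕ
open import Data.Fin using (Fin)
import Data.Fin as Fin
open import Data.Integer using (ℤ; +_; -_) renaming (_+_ to _+ℤ_)
open import Data.Maybe using (Maybe; just; nothing)
open import Data.Product using (Σ; ∃; _×_; _,_)
open import Data.Sum using (_⊎_)
open import Relation.Binary.PropositionalEquality using (_≡_; _≢_)
open import Relation.Nullary using (¬_; Dec; yes; no)
open import Relation.Binary.Definitions using (DecidableEquality)
open import Algebra.Structures using (IsCommutativeRing)
open import Function.Definitions using (Bijective)

sumFin : (n : ℕ) → (Fin n → ℤ) → ℤ
sumFin ℕ.zero    g = + 0
sumFin (ℕ.suc n) g = g Fin.zero +ℤ sumFin n (λ i → g (Fin.suc i))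

-- Every finite field of order 2^m is isomorphic to F_{2^m}, so quantifying
-- over all such structures is the same as speaking about F_q, q = 2^m.
record GF2 (m : ℕ) : Set₁ where
  infixl 6 _+_
  infixl 7 _*_
  field
    Carrier  : Set
    _+_ _*_  : Carrier → Carrier → Carrier
    neg      : Carrier → Carrier
    0# 1#    : Carrier
    isCommutativeRing : IsCommutativeRing _≡_ _+_ _*_ neg 0# 1#
    _≟_      : DecidableEquality Carrier
    1≢0      : 1# ≢ 0#
    inverse  : ∀ x → x ≢ 0# → ∃ λ y → x * y ≡ 1#
    char2    : ∀ x → x + x ≡ 0#
    enum     : Fin (2 ^ m) → Carrier
    enum-bij : Bijective _≡_ _≡_ enum

  sqIter : ℕ → Carrier → Carrier
  sqIter ℕ.zero    x = x
  sqIter (ℕ.suc i) x = sqIter i (x * x)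

  -- absolute trace F_{2^m} → F_2 ⊆ F : tr x = Σ_{i<m} x^(2^i)
  trAux : ℕ → Carrier → Carrier
  trAux ℕ.zero    x = 0#
  trAux (ℕ.suc i) x = sqIter i x + trAux i x

  tr : Carrier → Carrier
  tr = trAux m

  -- (-1)^t for t ∈ F_2 = {0#, 1#} ⊆ F
  χ : Carrier → ℤ
  χ t with t ≟ 0#
  ... | yes _ = + 1
  ... | no  _ = - (+ 1)

  ΣF : (Carrier → ℤ) → ℤ
  ΣF g = sumFin (2 ^ m) (λ i → g (enum i))

  q : ℕ
  q = 2 ^ m

  Walsh : (Carrier → Carrier → Carrier) → Carrier → Carrier → ℤ
  Walsh f a b = ΣF (λ x → ΣF (λ y → χ (f x y + tr (a * x + b * y))))

  IsBent : (Carrier → Carrier → Carrier) → Set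
  IsBent f = ∀ a b → Walsh f a b ≡ + q ⊎ Walsh f a b ≡ - (+ q)

  record IsPresemifield (_∘_ : Carrier → Carrier → Carrier) : Set where
    field
      distribʳ : ∀ x y z → (x + y) ∘ z ≡ x ∘ z + y ∘ z
      distribˡ : ∀ z x y → z ∘ (x + y) ≡ z ∘ x + z ∘ y
      zeroʳ    : ∀ x → x ∘ 0# ≡ 0#
      closed   : ∀ a b → a ≢ 0# → b ≢ 0# → a ∘ b ≢ 0#
      divˡ     : ∀ a b → a ≢ 0# → b ≢ 0# →
                 Σ Carrier λ x → (x ≢ 0#) × (a ∘ x ≡ b) × (∀ x′ → x′ ≢ 0# → a ∘ x′ ≡ b → x′ ≡ x)
      divʳ     : ∀ a b → a ≢ 0# → b ≢ 0# →
                 Σ Carrier λ y → (y ≢ 0#) × (y ∘ a ≡ b) × (∀ y′ → y′ ≢ 0# → y′ ∘ a ≡ b → y′ ≡ y)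

  IsTranspose : (_∘_ _⋆_ : Carrier → Carrier → Carrier) → Set
  IsTranspose _∘_ _⋆_ = ∀ x y z → tr ((x ⋆ z) * y) ≡ tr (x * (y ∘ z))

  data Line : Set where
    vert    : Carrier → Line
    nonvert : Carrier → Carrier → Line

  Point : Set
  Point = Carrier × Carrier

  On : (Carrier → Carrier → Carrier) → Line → Point → Set
  On _⋆_ (vert c)      (x , y) = x ≡ c
  On _⋆_ (nonvert b a) (x , y) = y ≡ (x ⋆ b) + a

  -- Line oval: a family of lines indexed by a set with q+1 elements
  -- (here Maybe Carrier), pairwise distinct (so the set has q+1 lines),
  -- no two parallel (distinct lines meet), no three through a common point.
  IsLineOval : (Carrier → Carrier → Carrier) → (Maybe Carrier → Line) → Set
  IsLineOval _⋆_ L =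
      (∀ i j → i ≢ j → ¬ (∀ p → (On _⋆_ (L i) p → On _⋆_ (L j) p) × (On _⋆_ (L j) p → On _⋆_ (L i) p)))
    × (∀ i j → i ≢ j → ∃ λ p → On _⋆_ (L i) p × On _⋆_ (L j) p)
    × (∀ i j k → i ≢ j → j ≢ k → i ≢ k →
         ¬ (∃ λ p → On _⋆_ (L i) p × On _⋆_ (L j) p × On _⋆_ (L k) p))

  ovalO : (Carrier → Carrier → Carrier) → Maybe Carrier → Line
  ovalO _⋆_ nothing  = vert 0#
  ovalO _⋆_ (just z) = nonvert z (z ⋆ z)

  InE : (Carrier → Carrier → Carrier) → Point → Set
  InE _⋆_ p = ∃ λ i → On _⋆_ (ovalO _⋆_ i) p

-- Write G z = z ⋆ z. Since ⋆ is commutative and transposed to ∘ through the nondegenerate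
-- trace form, it is bilinear without zero divisors, so G is additive and injective, hence
-- bijective. In the rows x ≢ 0 of the Walsh sum substitute y = x ∘ z; then
-- tr (G z * x + a * x + b * y) = tr (gap z * x) with gap z = b ⋆ z + G z + a, and
-- orthogonality of additive characters gives
--   W_f(a,b) = q · #{z | gap z = 0} − q + q · [b = 0].
-- The roots of gap are the lines y = x ⋆ z + G z of O through (b , a). For b = 0 there is
-- exactly one, and (b , a) also lies on x = 0; for b ≢ 0 the roots come in pairs {z , z + b}
-- because gap (z + u) = gap z + (b + u) ⋆ u, so there are two or none. Hence W_f(a,b) = ±q,
-- with sign + exactly on E(O). The oval axioms hold because two lines z ≢ w of O can only
-- meet at abscissa z + w.
-- Underneath lie the field facts x^q = x, tr x ∈ 𝔽₂ and tr ≢ 0.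

module Submission where

open import Defs
open import Level using (0ℓ)
open import Function using (_∘_; _∘′_)
open import Function.Definitions using (Injective; Bijective)
open import Data.Nat using (ℕ; zero; suc; _≥_; _≤_; z≤n; s≤s)
import Data.Nat as ℕ
import Data.Nat.Properties as ℕP
open import Data.Fin using (Fin; punchIn; punchOut)
import Data.Fin as Fin
import Data.Fin.Properties as FinP
open import Data.Product using (_×_; _,_; ∃; proj₁; proj₂)
open import Data.Sum using (_⊎_; inj₁; inj₂; [_,_])
import Data.Sum as Sum
open import Data.Empty using (⊥; ⊥-elim)
open import Data.List using (List; []; _∷_; length)
open import Data.List.Relation.Unary.All using (All; []; _∷_)
open import Relation.Binary.PropositionalEquality using (_≡_; _≢_; refl; sym; trans; cong; cong₂; subst; module ≡-Reasoning)
open import Data.Integer using (ℤ; +_; -_; -[1+_]) renaming (_+_ to _+ℤ_)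
import Data.Integer.Properties as ℤP
open import Data.Maybe using (Maybe; just; nothing)
open import Relation.Nullary using (¬_; Dec; yes; no; contradiction)
open import Relation.Nullary.Decidable using (map′)
open import Relation.Unary using (Pred; Decidable)
open import Algebra.Core using (Op₂)
open import Algebra.Bundles using (CommutativeMonoid; CommutativeRing; AbelianGroup)
import Algebra.Properties.Group as GroupProperties
import Algebra.Properties.Quasigroup as QuasigroupProperties
import Algebra.Properties.CommutativeSemigroup as CommutativeSemigroupProperties
import Algebra.Properties.Semiring.Exp as SemiringExp
open import Algebra.Structures using (IsCommutativeMonoid; IsCommutativeRing)
import Algebra.Properties.CommutativeMonoid.Sum as CommutativeMonoidSum
import Algebra.Properties.Monoid.Mult as MonoidMultiples
open import Data.Fin.Permutation using (Permutation; permutation; _⟨$⟩ʳ_)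

Fin-injective⇒surjective : ∀ {n} (f : Fin n → Fin n) → Injective _≡_ _≡_ f → ∀ j → ∃ λ i → f i ≡ j
Fin-injective⇒surjective {suc n} f f-injective j with FinP.any? (λ i → f i Fin.≟ j)
... | yes found = found
... | no missed = contradiction (FinP.injective⇒≤ avoid-injective) ℕP.1+n≰n
  where
  j≢f : ∀ i → j ≢ f i
  j≢f i j≡fi = missed (i , sym j≡fi)
  avoid-injective : Injective _≡_ _≡_ (λ i → punchOut (j≢f i))
  avoid-injective eq = f-injective (FinP.punchOut-injective (j≢f _) (j≢f _) eq)

module Enumeration {A : Set} {n : ℕ} {enum : Fin n → A} (enum-bijective : Bijective _≡_ _≡_ enum) where

  enum⁻¹ : A → Fin n
  enum⁻¹ x = proj₁ (proj₂ enum-bijective x)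

  enum-enum⁻¹ : ∀ x → enum (enum⁻¹ x) ≡ x
  enum-enum⁻¹ x = proj₂ (proj₂ enum-bijective x) refl

  enum⁻¹-enum : ∀ i → enum⁻¹ (enum i) ≡ i
  enum⁻¹-enum i = proj₁ enum-bijective (enum-enum⁻¹ (enum i))

  enum-≢ : ∀ {i x} → i ≢ enum⁻¹ x → enum i ≢ x
  enum-≢ {i} i≢ refl = i≢ (sym (enum⁻¹-enum i))

  any? : {P : Pred A 0ℓ} → Decidable P → Dec (∃ P)
  any? {P} P? = map′ (λ (i , p) → enum i , p)
                     (λ (x , p) → enum⁻¹ x , subst P (sym (enum-enum⁻¹ x)) p)
                     (FinP.any? (P? ∘ enum))

  injective⇒surjective : (h : A → A) → Injective _≡_ _≡_ h → ∀ y → ∃ λ x → h x ≡ y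
  injective⇒surjective h h-injective y =
    let (i , hi≡y) = Fin-injective⇒surjective (enum⁻¹ ∘ h ∘ enum) conj-injective (enum⁻¹ y)
    in enum i , trans (sym (enum-enum⁻¹ _)) (trans (cong enum hi≡y) (enum-enum⁻¹ y))
    where
    conj-injective : Injective _≡_ _≡_ (enum⁻¹ ∘ h ∘ enum)
    conj-injective eq = proj₁ enum-bijective
      (h-injective (trans (sym (enum-enum⁻¹ _)) (trans (cong enum eq) (enum-enum⁻¹ _))))

module Summation {M : Set} {_∙_ : Op₂ M} {ε : M} (isCommutativeMonoid : IsCommutativeMonoid _≡_ _∙_ ε) where

  commutativeMonoid : CommutativeMonoid 0ℓ 0ℓ
  commutativeMonoid = record { isCommutativeMonoid = isCommutativeMonoid }

  open CommutativeMonoid commutativeMonoid using (identityʳ; commutativeSemigroup)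
  open CommutativeSemigroupProperties commutativeSemigroup using (xy∙z≈zy∙x)
  open CommutativeMonoidSum commutativeMonoid public using (sum)
  open CommutativeMonoidSum commutativeMonoid
    using (sum-remove; sum-cong-≗; sum-replicate-zero; sum-replicate; ∑-distrib-+; ∑-comm; sum-permute)
  open MonoidMultiples (CommutativeMonoid.monoid commutativeMonoid) public
    using () renaming (_×_ to _·_)
  open ≡-Reasoning

  sum-single : ∀ {n} (t : Fin n → M) i → (∀ j → j ≢ i → t j ≡ ε) → sum t ≡ t i
  sum-single {suc n} t i vanish = begin
    sum t                     ≡⟨ sum-remove {i = i} t ⟩
    t i ∙ sum (t ∘ punchIn i) ≡⟨ cong (t i ∙_) (sum-cong-≗ {n} (λ j → vanish _ (FinP.punchInᵢ≢i i j))) ⟩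
    t i ∙ sum {n} (λ _ → ε)   ≡⟨ cong (t i ∙_) (sum-replicate-zero n) ⟩
    t i ∙ ε                   ≡⟨ identityʳ (t i) ⟩
    t i                       ∎

  sum-pair : ∀ {n} (t : Fin n → M) {i j} → i ≢ j → (∀ k → k ≢ i → k ≢ j → t k ≡ ε) → sum t ≡ t i ∙ t j
  sum-pair {suc n} t {i} {j} i≢j vanish = begin
    sum t                                ≡⟨ sum-remove {i = i} t ⟩
    t i ∙ sum (t ∘ punchIn i)            ≡⟨ cong (t i ∙_) (sum-single (t ∘ punchIn i) j′ vanish′) ⟩
    t i ∙ t (punchIn i j′)               ≡⟨ cong (λ k → t i ∙ t k) (FinP.punchIn-punchOut i≢j) ⟩
    t i ∙ t j                            ∎
    where
    j′ = punchOut i≢j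
    vanish′ : ∀ k → k ≢ j′ → t (punchIn i k) ≡ ε
    vanish′ k k≢j′ = vanish _ (FinP.punchInᵢ≢i i k) λ ik≡j →
      k≢j′ (FinP.punchIn-injective i k j′ (trans ik≡j (sym (FinP.punchIn-punchOut i≢j))))

  sum-agree-except : ∀ {n} (t u : Fin n → M) i → (∀ j → j ≢ i → t j ≡ u j) → sum t ∙ u i ≡ sum u ∙ t i
  sum-agree-except {suc n} t u i agree = begin
    sum t ∙ u i                ≡⟨ cong (_∙ u i) (sum-remove {i = i} t) ⟩
    (t i ∙ sum t′) ∙ u i       ≡⟨ cong (λ r → (t i ∙ r) ∙ u i) (sum-cong-≗ {n} (agree _ ∘ FinP.punchInᵢ≢i i)) ⟩
    (t i ∙ sum u′) ∙ u i       ≡⟨ xy∙z≈zy∙x (t i) (sum u′) (u i) ⟩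
    (u i ∙ sum u′) ∙ t i       ≡⟨ cong (_∙ t i) (sum-remove {i = i} u) ⟨
    sum u ∙ t i                ∎
    where
    t′ = t ∘ punchIn i
    u′ = u ∘ punchIn i

  sum-closed : (P : M → Set) → P ε → (∀ {x y} → P x → P y → P (x ∙ y)) →
               ∀ {n} (t : Fin n → M) → (∀ i → P (t i)) → P (sum t)
  sum-closed P Pε P∙ {zero}  t Pt = Pε
  sum-closed P Pε P∙ {suc n} t Pt = P∙ (Pt Fin.zero) (sum-closed P Pε P∙ (t ∘ Fin.suc) (Pt ∘ Fin.suc))

  module Over {A : Set} {n : ℕ} {enum : Fin n → A} (enum-bijective : Bijective _≡_ _≡_ enum) where
    open Enumeration enum-bijective

    ∑ : (A → M) → M
    ∑ g = sum (g ∘ enum)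

    ∑-cong : ∀ {g h : A → M} → (∀ x → g x ≡ h x) → ∑ g ≡ ∑ h
    ∑-cong g≗h = sum-cong-≗ {n} (g≗h ∘ enum)

    ∑-distrib : ∀ (g h : A → M) → ∑ (λ x → g x ∙ h x) ≡ ∑ g ∙ ∑ h
    ∑-distrib g h = ∑-distrib-+ (g ∘ enum) (h ∘ enum)

    ∑-swap : ∀ (g : A → A → M) → ∑ (λ x → ∑ (g x)) ≡ ∑ (λ y → ∑ (λ x → g x y))
    ∑-swap g = ∑-comm (λ i j → g (enum i) (enum j))

    ∑-const : ∀ c → ∑ (λ _ → c) ≡ n · c
    ∑-const c = sum-replicate n

    ∑-zero : ∀ (g : A → M) → (∀ x → g x ≡ ε) → ∑ g ≡ ε
    ∑-zero g g≡ε = trans (sum-cong-≗ {n} (g≡ε ∘ enum)) (sum-replicate-zero n)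

    ∑-closed : (P : M → Set) → P ε → (∀ {x y} → P x → P y → P (x ∙ y)) →
               ∀ g → (∀ x → P (g x)) → P (∑ g)
    ∑-closed P Pε P∙ g Pg = sum-closed P Pε P∙ (g ∘ enum) (Pg ∘ enum)

    ∑-single : ∀ (g : A → M) x₀ → (∀ x → x ≢ x₀ → g x ≡ ε) → ∑ g ≡ g x₀
    ∑-single g x₀ vanish = trans (sum-single (g ∘ enum) (enum⁻¹ x₀) (λ i → vanish _ ∘ enum-≢))
                                 (cong g (enum-enum⁻¹ x₀))

    ∑-pair : ∀ (g : A → M) {x₀ x₁} → x₀ ≢ x₁ → (∀ x → x ≢ x₀ → x ≢ x₁ → g x ≡ ε) →
             ∑ g ≡ g x₀ ∙ g x₁
    ∑-pair g {x₀} {x₁} x₀≢x₁ vanish =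
      trans (sum-pair (g ∘ enum) (x₀≢x₁ ∘ enum⁻¹-injective) (λ i i≢x₀ i≢x₁ → vanish _ (enum-≢ i≢x₀) (enum-≢ i≢x₁)))
            (cong₂ _∙_ (cong g (enum-enum⁻¹ x₀)) (cong g (enum-enum⁻¹ x₁)))
      where
      enum⁻¹-injective : enum⁻¹ x₀ ≡ enum⁻¹ x₁ → x₀ ≡ x₁
      enum⁻¹-injective eq = trans (sym (enum-enum⁻¹ x₀)) (trans (cong enum eq) (enum-enum⁻¹ x₁))

    ∑-agree-except : ∀ (g h : A → M) x₀ → (∀ x → x ≢ x₀ → g x ≡ h x) → ∑ g ∙ h x₀ ≡ ∑ h ∙ g x₀
    ∑-agree-except g h x₀ agree = begin
      ∑ g ∙ h x₀                     ≡⟨ cong (λ x → ∑ g ∙ h x) (sym (enum-enum⁻¹ x₀)) ⟩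
      ∑ g ∙ h (enum (enum⁻¹ x₀))     ≡⟨ sum-agree-except (g ∘ enum) (h ∘ enum) _ (λ i → agree _ ∘ enum-≢) ⟩
      ∑ h ∙ g (enum (enum⁻¹ x₀))     ≡⟨ cong (λ x → ∑ h ∙ g x) (enum-enum⁻¹ x₀) ⟩
      ∑ h ∙ g x₀                     ∎

    ∑-reindex : ∀ (g : A → M) (h : A → A) → Injective _≡_ _≡_ h → ∑ (g ∘ h) ≡ ∑ g
    ∑-reindex g h h-injective = begin
      ∑ (g ∘ h)                                ≡⟨ sum-cong-≗ {n} (cong g ∘ enum-enum⁻¹ ∘ h ∘ enum) ⟨
      sum (g ∘ enum ∘ (π ⟨$⟩ʳ_))               ≡⟨ sum-permute (g ∘ enum) π ⟨
      ∑ g                                      ∎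
      where
      h⁻¹ : A → A
      h⁻¹ y = proj₁ (injective⇒surjective h h-injective y)
      h-h⁻¹ : ∀ y → h (h⁻¹ y) ≡ y
      h-h⁻¹ y = proj₂ (injective⇒surjective h h-injective y)
      h⁻¹-h : ∀ x → h⁻¹ (h x) ≡ x
      h⁻¹-h x = h-injective (h-h⁻¹ (h x))
      π : Permutation n n
      π = permutation (enum⁻¹ ∘ h ∘ enum) (enum⁻¹ ∘ h⁻¹ ∘ enum)
        (λ i → trans (cong (enum⁻¹ ∘ h) (enum-enum⁻¹ _)) (trans (cong enum⁻¹ (h-h⁻¹ _)) (enum⁻¹-enum i)))
        (λ i → trans (cong (enum⁻¹ ∘ h⁻¹) (enum-enum⁻¹ _)) (trans (cong enum⁻¹ (h⁻¹-h _)) (enum⁻¹-enum i)))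

module IntegerSummation where
  open Summation ℤP.+-0-isCommutativeMonoid public
  open GroupProperties (AbelianGroup.group ℤP.+-0-abelianGroup) using (quasigroup)
  open QuasigroupProperties quasigroup public using () renaming (cancelʳ to +ℤ-cancelʳ)

  sumFin≡sum : ∀ n (t : Fin n → ℤ) → sumFin n t ≡ sum t
  sumFin≡sum zero    t = refl
  sumFin≡sum (suc n) t = cong (t Fin.zero +ℤ_) (sumFin≡sum n (t ∘ Fin.suc))

  sum-neg : ∀ {n} (t : Fin n → ℤ) → sum (λ i → - t i) ≡ - sum t
  sum-neg {zero}  t = refl
  sum-neg {suc n} t = trans (cong (- t Fin.zero +ℤ_) (sum-neg (t ∘ Fin.suc))) (sym (ℤP.neg-distrib-+ (t Fin.zero) _))

  ·-+1 : ∀ n → n · + 1 ≡ + n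
  ·-+1 zero    = refl
  ·-+1 (suc n) = cong (+ 1 +ℤ_) (·-+1 n)

  i≡-i⇒i≡0 : ∀ {i} → i ≡ - i → i ≡ + 0
  i≡-i⇒i≡0 {+ zero}  _  = refl
  i≡-i⇒i≡0 {+ suc n} ()
  i≡-i⇒i≡0 { -[1+ n ]} ()

module CharacteristicTwo {m : ℕ} (F : GF2 m) where
  open GF2 F public
  open IsCommutativeRing isCommutativeRing public
    using (+-assoc; +-comm; +-congˡ; +-congʳ; +-identityˡ; +-identityʳ; *-assoc; *-comm; *-identityˡ; *-identityʳ;
           distribˡ; distribʳ; zeroˡ; zeroʳ; *-isCommutativeMonoid)

  commutativeRing : CommutativeRing 0ℓ 0ℓ
  commutativeRing = record { isCommutativeRing = isCommutativeRing }

  open CommutativeSemigroupProperties (CommutativeRing.+-commutativeSemigroup commutativeRing) public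
    using () renaming (interchange to +-interchange; x∙yz≈zx∙y to x+yz≡zx+y; xy∙z≈xz∙y to xy+z≡xz+y)
  open CommutativeSemigroupProperties (CommutativeRing.*-commutativeSemigroup commutativeRing) public
    using () renaming (interchange to *-interchange)
  open SemiringExp (CommutativeRing.semiring commutativeRing) public using (_^_; ^-assocʳ)
  open ≡-Reasoning

  cancel-twiceˡ : ∀ x y → x + (x + y) ≡ y
  cancel-twiceˡ x y = trans (sym (+-assoc x x y)) (trans (cong (_+ y) (char2 x)) (+-identityˡ y))

  cancel-twiceʳ : ∀ x y → (x + y) + y ≡ x
  cancel-twiceʳ x y = trans (+-assoc x y y) (trans (+-congˡ (char2 y)) (+-identityʳ x))

  x+y≡0⇒x≡y : ∀ {x y} → x + y ≡ 0# → x ≡ y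
  x+y≡0⇒x≡y {x} {y} x+y≡0 = trans (sym (cancel-twiceʳ x y)) (trans (cong (_+ y) x+y≡0) (+-identityˡ y))

  x≡y⇒x+y≡0 : ∀ {x y} → x ≡ y → x + y ≡ 0#
  x≡y⇒x+y≡0 {x} refl = char2 x

  x+y≡z⇒x≡z+y : ∀ {x y z} → x + y ≡ z → x ≡ z + y
  x+y≡z⇒x≡z+y {x} {y} refl = sym (cancel-twiceʳ x y)

  +-cancelˡ : ∀ a {x y} → a + x ≡ a + y → x ≡ y
  +-cancelˡ a {x} {y} eq = trans (sym (cancel-twiceˡ a x)) (trans (+-congˡ eq) (cancel-twiceˡ a y))

  x*y≡0⇒x≡0⊎y≡0 : ∀ {x y} → x * y ≡ 0# → x ≡ 0# ⊎ y ≡ 0#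
  x*y≡0⇒x≡0⊎y≡0 {x} {y} xy≡0 with x ≟ 0#
  ... | yes x≡0 = inj₁ x≡0
  ... | no  x≢0 = let (x⁻¹ , xx⁻¹≡1) = inverse x x≢0 in inj₂ (begin
    y              ≡⟨ sym (trans (cong (_* y) xx⁻¹≡1) (*-identityˡ y)) ⟩
    (x * x⁻¹) * y  ≡⟨ trans (cong (_* y) (*-comm x x⁻¹)) (*-assoc x⁻¹ x y) ⟩
    x⁻¹ * (x * y)  ≡⟨ trans (cong (x⁻¹ *_) xy≡0) (zeroʳ x⁻¹) ⟩
    0#             ∎)

  *-≢0 : ∀ {x y} → x ≢ 0# → y ≢ 0# → x * y ≢ 0#
  *-≢0 x≢0 y≢0 xy≡0 with x*y≡0⇒x≡0⊎y≡0 xy≡0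
  ... | inj₁ x≡0 = x≢0 x≡0
  ... | inj₂ y≡0 = y≢0 y≡0

  *-cancelˡ-≢0 : ∀ {a x y} → a ≢ 0# → a * x ≡ a * y → x ≡ y
  *-cancelˡ-≢0 {a} {x} {y} a≢0 eq with x*y≡0⇒x≡0⊎y≡0 (trans (distribˡ a x y) (x≡y⇒x+y≡0 eq))
  ... | inj₁ a≡0 = ⊥-elim (a≢0 a≡0)
  ... | inj₂ x+y≡0 = x+y≡0⇒x≡y x+y≡0

  divide : ∀ {a} → a ≢ 0# → ∀ b → ∃ λ x → a * x ≡ b
  divide {a} a≢0 b = let (a⁻¹ , aa⁻¹≡1) = inverse a a≢0 in
    a⁻¹ * b , trans (sym (*-assoc a a⁻¹ b)) (trans (cong (_* b) aa⁻¹≡1) (*-identityˡ b))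

  idempotent⇒0⊎1 : ∀ {t} → t * t ≡ t → t ≡ 0# ⊎ t ≡ 1#
  idempotent⇒0⊎1 {t} tt≡t with x*y≡0⇒x≡0⊎y≡0 [t+1]t≡0
    where
    [t+1]t≡0 : (t + 1#) * t ≡ 0#
    [t+1]t≡0 = trans (distribʳ t t 1#) (x≡y⇒x+y≡0 (trans tt≡t (sym (*-identityˡ t))))
  ... | inj₁ t+1≡0 = inj₂ (x+y≡0⇒x≡y t+1≡0)
  ... | inj₂ t≡0   = inj₁ t≡0

  square-+ : ∀ x y → (x + y) * (x + y) ≡ x * x + y * y
  square-+ x y = begin
    (x + y) * (x + y)                   ≡⟨ trans (distribˡ (x + y) x y) (cong₂ _+_ (distribʳ x x y) (distribʳ y x y)) ⟩
    (x * x + y * x) + (x * y + y * y)   ≡⟨ cong (λ t → (x * x + t) + (x * y + y * y)) (*-comm y x) ⟩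
    (x * x + x * y) + (x * y + y * y)   ≡⟨ trans (+-assoc (x * x) _ _) (+-congˡ (cancel-twiceˡ (x * y) (y * y))) ⟩
    x * x + y * y                       ∎

  sqIter-+ : ∀ i x y → sqIter i (x + y) ≡ sqIter i x + sqIter i y
  sqIter-+ zero    x y = refl
  sqIter-+ (suc i) x y = trans (cong (sqIter i) (square-+ x y)) (sqIter-+ i (x * x) (y * y))

  sqIter-* : ∀ i x y → sqIter i (x * y) ≡ sqIter i x * sqIter i y
  sqIter-* zero    x y = refl
  sqIter-* (suc i) x y = trans (cong (sqIter i) (*-interchange x y x y)) (sqIter-* i (x * x) (y * y))

  sqIter-0 : ∀ i → sqIter i 0# ≡ 0#
  sqIter-0 zero    = refl
  sqIter-0 (suc i) = trans (cong (sqIter i) (zeroˡ 0#)) (sqIter-0 i)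

  sqIter≡^ : ∀ i x → sqIter i x ≡ x ^ (2 ℕ.^ i)
  sqIter≡^ zero    x = sym (*-identityʳ x)
  sqIter≡^ (suc i) x = begin
    sqIter i (x * x)      ≡⟨ sqIter≡^ i (x * x) ⟩
    (x * x) ^ (2 ℕ.^ i)   ≡⟨ cong (λ y → (x * y) ^ (2 ℕ.^ i)) (sym (*-identityʳ x)) ⟩
    (x ^ 2) ^ (2 ℕ.^ i)   ≡⟨ ^-assocʳ x 2 (2 ℕ.^ i) ⟩
    x ^ (2 ℕ.^ suc i)     ∎

  trAux-+ : ∀ i x y → trAux i (x + y) ≡ trAux i x + trAux i y
  trAux-+ zero    x y = sym (+-identityˡ 0#)
  trAux-+ (suc i) x y = trans (cong₂ _+_ (sqIter-+ i x y) (trAux-+ i x y)) (+-interchange _ _ _ _)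

  trAux-0 : ∀ i → trAux i 0# ≡ 0#
  trAux-0 zero    = refl
  trAux-0 (suc i) = trans (cong₂ _+_ (sqIter-0 i) (trAux-0 i)) (+-identityˡ 0#)

  tr-+ : ∀ x y → tr (x + y) ≡ tr x + tr y
  tr-+ = trAux-+ m

  tr-0 : tr 0# ≡ 0#
  tr-0 = trAux-0 m

module Fermat {m : ℕ} (F : GF2 m) where
  open CharacteristicTwo F
  open Summation.Over *-isCommutativeMonoid enum-bij
    renaming (∑ to ∏; ∑-cong to ∏-cong; ∑-distrib to ∏-distrib; ∑-const to ∏-const;
              ∑-single to ∏-single; ∑-reindex to ∏-reindex; ∑-closed to ∏-closed)
  open ≡-Reasoning

  orOne : Carrier → Carrier
  orOne x with x ≟ 0#
  ... | yes _ = 1#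
  ... | no  _ = x

  atZero : Carrier → Carrier → Carrier
  atZero a x with x ≟ 0#
  ... | yes _ = a
  ... | no  _ = 1#

  orOne-≢0 : ∀ x → orOne x ≢ 0#
  orOne-≢0 x with x ≟ 0#
  ... | yes _   = 1≢0
  ... | no  x≢0 = x≢0

  atZero-0 : ∀ a → atZero a 0# ≡ a
  atZero-0 a with 0# ≟ 0#
  ... | yes _   = refl
  ... | no  0≢0 = ⊥-elim (0≢0 refl)

  atZero-≢0 : ∀ a {x} → x ≢ 0# → atZero a x ≡ 1#
  atZero-≢0 a {x} x≢0 with x ≟ 0#
  ... | yes x≡0 = ⊥-elim (x≢0 x≡0)
  ... | no  _   = refl

  orOne-scale : ∀ {a} → a ≢ 0# → ∀ x → orOne x * a ≡ orOne (a * x) * atZero a x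
  orOne-scale {a} a≢0 x with x ≟ 0# | (a * x) ≟ 0#
  ... | yes _   | yes _     = refl
  ... | yes x≡0 | no  ax≢0  = ⊥-elim (ax≢0 (trans (cong (a *_) x≡0) (zeroʳ a)))
  ... | no  x≢0 | yes ax≡0  = ⊥-elim (*-≢0 a≢0 x≢0 ax≡0)
  ... | no  _   | no  _     = trans (*-comm x a) (sym (*-identityʳ (a * x)))

  -- Multiplying every factor of ∏ orOne by a permutes the nonzero factors and turns the factor 1 into a.
  ^q-≢0 : ∀ {a} → a ≢ 0# → a ^ q ≡ a
  ^q-≢0 {a} a≢0 = *-cancelˡ-≢0 P≢0 (begin
    P * a ^ q                                   ≡⟨ cong (P *_) (sym (∏-const a)) ⟩
    P * ∏ (λ _ → a)                             ≡⟨ sym (∏-distrib orOne (λ _ → a)) ⟩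
    ∏ (λ x → orOne x * a)                       ≡⟨ ∏-cong (orOne-scale a≢0) ⟩
    ∏ (λ x → orOne (a * x) * atZero a x)        ≡⟨ ∏-distrib (orOne ∘ (a *_)) (atZero a) ⟩
    ∏ (orOne ∘ (a *_)) * ∏ (atZero a)           ≡⟨ cong₂ _*_ (∏-reindex orOne (a *_) (*-cancelˡ-≢0 a≢0))
                                                             (∏-single (atZero a) 0# (λ _ → atZero-≢0 a)) ⟩
    P * atZero a 0#                             ≡⟨ cong (P *_) (atZero-0 a) ⟩
    P * a                                       ∎)
    where
    P = ∏ orOne
    P≢0 : P ≢ 0#
    P≢0 = ∏-closed (_≢ 0#) 1≢0 *-≢0 orOne orOne-≢0

  fermat : ∀ a → sqIter m a ≡ a
  fermat a with a ≟ 0#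
  ... | yes refl = sqIter-0 m
  ... | no  a≢0  = trans (sqIter≡^ m a) (^q-≢0 a≢0)

module TraceValues {m : ℕ} (F : GF2 m) where
  open CharacteristicTwo F
  open Fermat F using (fermat)
  open ≡-Reasoning

  trAux-telescope : ∀ i x → trAux i (x * x) + x ≡ trAux i x + sqIter i x
  trAux-telescope zero    x = refl
  trAux-telescope (suc i) x = begin
    (sqIter i (x * x) + trAux i (x * x)) + x   ≡⟨ +-assoc _ _ x ⟩
    sqIter i (x * x) + (trAux i (x * x) + x)   ≡⟨ +-congˡ (trAux-telescope i x) ⟩
    sqIter i (x * x) + (trAux i x + sqIter i x) ≡⟨ +-comm _ _ ⟩
    (trAux i x + sqIter i x) + sqIter i (x * x) ≡⟨ cong (_+ sqIter i (x * x)) (+-comm _ _) ⟩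
    (sqIter i x + trAux i x) + sqIter i (x * x) ∎

  tr-square : ∀ x → tr (x * x) ≡ tr x
  tr-square x = begin
    tr (x * x)          ≡⟨ x+y≡z⇒x≡z+y (trans (trAux-telescope m x) (+-congˡ (fermat x))) ⟩
    (tr x + x) + x      ≡⟨ cancel-twiceʳ (tr x) x ⟩
    tr x                ∎

  square-trAux : ∀ i x → trAux i x * trAux i x ≡ trAux i (x * x)
  square-trAux zero    x = zeroˡ 0#
  square-trAux (suc i) x = trans (square-+ (sqIter i x) (trAux i x))
                                 (cong₂ _+_ (sym (sqIter-* i x x)) (square-trAux i x))

  tr∈𝔽₂ : ∀ x → tr x ≡ 0# ⊎ tr x ≡ 1#
  tr∈𝔽₂ x = idempotent⇒0⊎1 (trans (square-trAux m x) (tr-square x))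

module Polynomial {m : ℕ} (F : GF2 m) where
  open CharacteristicTwo F
  open ≡-Reasoning

  Poly : Set
  Poly = List Carrier

  eval : Poly → Carrier → Carrier
  eval []      x = 0#
  eval (c ∷ p) x = c + x * eval p x

  c+x*0≡c : ∀ c x → c + x * 0# ≡ c
  c+x*0≡c c x = trans (+-congˡ (zeroʳ x)) (+-identityʳ c)

  IsZero : Poly → Set
  IsZero = All (_≡ 0#)

  coeff : Poly → ℕ → Carrier
  coeff []      k       = 0#
  coeff (c ∷ p) zero    = c
  coeff (c ∷ p) (suc k) = coeff p k

  coeff-IsZero : ∀ p k → IsZero p → coeff p k ≡ 0#
  coeff-IsZero []      k       _           = refl
  coeff-IsZero (c ∷ p) zero    (c≡0 ∷ _)   = c≡0
  coeff-IsZero (c ∷ p) (suc k) (_ ∷ p≡0)   = coeff-IsZero p k p≡0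

  infixl 6 _+ᴾ_
  _+ᴾ_ : Poly → Poly → Poly
  []      +ᴾ q       = q
  (a ∷ p) +ᴾ []      = a ∷ p
  (a ∷ p) +ᴾ (b ∷ q) = (a + b) ∷ (p +ᴾ q)

  eval-+ᴾ : ∀ p q x → eval (p +ᴾ q) x ≡ eval p x + eval q x
  eval-+ᴾ []      q       x = sym (+-identityˡ _)
  eval-+ᴾ (a ∷ p) []      x = sym (+-identityʳ _)
  eval-+ᴾ (a ∷ p) (b ∷ q) x = begin
    (a + b) + x * eval (p +ᴾ q) x              ≡⟨ cong (λ y → (a + b) + x * y) (eval-+ᴾ p q x) ⟩
    (a + b) + x * (eval p x + eval q x)        ≡⟨ +-congˡ (distribˡ x _ _) ⟩
    (a + b) + (x * eval p x + x * eval q x)    ≡⟨ +-interchange a b _ _ ⟩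
    (a + x * eval p x) + (b + x * eval q x)    ∎

  coeff-+ᴾ : ∀ p q k → coeff (p +ᴾ q) k ≡ coeff p k + coeff q k
  coeff-+ᴾ []      q       k       = sym (+-identityˡ _)
  coeff-+ᴾ (a ∷ p) []      k       = sym (+-identityʳ _)
  coeff-+ᴾ (a ∷ p) (b ∷ q) zero    = refl
  coeff-+ᴾ (a ∷ p) (b ∷ q) (suc k) = coeff-+ᴾ p q k

  length-+ᴾ : ∀ {n} p q → length p ≤ n → length q ≤ n → length (p +ᴾ q) ≤ n
  length-+ᴾ []      q       _        |q|≤n    = |q|≤n
  length-+ᴾ (a ∷ p) []      |p|≤n    _        = |p|≤n
  length-+ᴾ (a ∷ p) (b ∷ q) (s≤s |p|≤n) (s≤s |q|≤n) = s≤s (length-+ᴾ p q |p|≤n |q|≤n)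

  monomial : ℕ → Poly
  monomial zero    = 1# ∷ []
  monomial (suc k) = 0# ∷ monomial k

  eval-monomial : ∀ k x → eval (monomial k) x ≡ x ^ k
  eval-monomial zero    x = c+x*0≡c 1# x
  eval-monomial (suc k) x = trans (+-identityˡ _) (cong (x *_) (eval-monomial k x))

  length-monomial : ∀ k → length (monomial k) ≡ suc k
  length-monomial zero    = refl
  length-monomial (suc k) = cong suc (length-monomial k)

  coeff-monomial-≢ : ∀ {j k} → j ≢ k → coeff (monomial j) k ≡ 0#
  coeff-monomial-≢ {zero}  {zero}  j≢k = ⊥-elim (j≢k refl)
  coeff-monomial-≢ {zero}  {suc k} _   = refl
  coeff-monomial-≢ {suc j} {zero}  _   = refl
  coeff-monomial-≢ {suc j} {suc k} j≢k = coeff-monomial-≢ (j≢k ∘ cong suc)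

  -- Synthetic division by x + r (= x − r in characteristic 2).
  quot : Carrier → Poly → Poly
  quot r []                = []
  quot r (c ∷ [])          = []
  quot r (c ∷ p@(_ ∷ _))   = eval p r ∷ quot r p

  length-quot : ∀ r c p → length (quot r (c ∷ p)) ≡ length p
  length-quot r c []      = refl
  length-quot r c (d ∷ p) = cong suc (length-quot r d p)

  eval-quot : ∀ r p x → eval p x ≡ eval p r + (x + r) * eval (quot r p) x
  eval-quot r []                x = sym (c+x*0≡c 0# (x + r))
  eval-quot r (c ∷ [])          x = trans (c+x*0≡c c x) (sym (trans (c+x*0≡c _ (x + r)) (c+x*0≡c c r)))
  eval-quot r (c ∷ p@(_ ∷ _))   x = begin
    c + x * eval p x                          ≡⟨ cong (λ y → c + x * y) (eval-quot r p x) ⟩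
    c + x * (pr + (x + r) * Q)                ≡⟨ +-congˡ (distribˡ x pr _) ⟩
    c + (x * pr + x * ((x + r) * Q))          ≡⟨ cong (λ y → c + (x * pr + y)) x[x+r]Q ⟩
    c + (x * pr + (x + r) * (x * Q))          ≡⟨ cong (λ y → c + (y + (x + r) * (x * Q))) x*pr ⟩
    c + ((r * pr + (x + r) * pr) + (x + r) * (x * Q))
                                              ≡⟨ +-congˡ (trans (+-assoc _ _ _) (+-congˡ (sym (distribˡ (x + r) pr _)))) ⟩
    c + (r * pr + (x + r) * (pr + x * Q))     ≡⟨ sym (+-assoc c _ _) ⟩
    (c + r * pr) + (x + r) * (pr + x * Q)     ∎
    where
    pr = eval p r
    Q  = eval (quot r p) x
    x[x+r]Q : x * ((x + r) * Q) ≡ (x + r) * (x * Q)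
    x[x+r]Q = trans (sym (*-assoc x _ Q)) (trans (cong (_* Q) (*-comm x (x + r))) (*-assoc (x + r) x Q))
    x*pr : x * pr ≡ r * pr + (x + r) * pr
    x*pr = sym (trans (sym (distribʳ pr r (x + r))) (cong (_* pr) (trans (+-comm r (x + r)) (cancel-twiceʳ x r))))

  quot-IsZero : ∀ r p → IsZero (quot r p) → eval p r ≡ 0# → IsZero p
  quot-IsZero r []                _        _      = []
  quot-IsZero r (c ∷ [])          _              p[r]≡0 = trans (sym (c+x*0≡c c r)) p[r]≡0 ∷ []
  quot-IsZero r (c ∷ p@(_ ∷ _))   (p[r]≡0 ∷ q≡0) cp[r]≡0 =
    trans (sym (trans (cong (λ y → c + r * y) p[r]≡0) (c+x*0≡c c r))) cp[r]≡0 ∷ quot-IsZero r p q≡0 p[r]≡0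

  roots⇒IsZero : ∀ {n} (rs : Fin n → Carrier) → Injective _≡_ _≡_ rs →
                 ∀ p → (∀ i → eval p (rs i) ≡ 0#) → length p ≤ n → IsZero p
  roots⇒IsZero rs _ [] _ _ = []
  roots⇒IsZero {suc n} rs rs-injective (c ∷ p) roots (s≤s |p|≤n) =
    quot-IsZero r (c ∷ p)
      (roots⇒IsZero (rs ∘ Fin.suc) (FinP.suc-injective ∘ rs-injective) (quot r (c ∷ p)) quot-roots
                    (subst (_≤ n) (sym (length-quot r c p)) |p|≤n))
      (roots Fin.zero)
    where
    r = rs Fin.zero
    quot-roots : ∀ i → eval (quot r (c ∷ p)) (rs (Fin.suc i)) ≡ 0#
    quot-roots i with x*y≡0⇒x≡0⊎y≡0 factored
      where
      x = rs (Fin.suc i)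
      Q = eval (quot r (c ∷ p)) x
      factored : (x + r) * Q ≡ 0#
      factored = begin
        (x + r) * Q                    ≡⟨ sym (trans (+-congʳ (roots Fin.zero)) (+-identityˡ _)) ⟩
        eval (c ∷ p) r + (x + r) * Q   ≡⟨ sym (eval-quot r (c ∷ p) x) ⟩
        eval (c ∷ p) x                 ≡⟨ roots (Fin.suc i) ⟩
        0#                             ∎
    ... | inj₁ x+r≡0 = contradiction (rs-injective {Fin.suc i} {Fin.zero} (x+y≡0⇒x≡y x+r≡0)) λ ()
    ... | inj₂ q≡0   = q≡0

module TraceNondegeneracy {m : ℕ} (F : GF2 m) where
  open CharacteristicTwo F
  open Polynomial F
  open TraceValues F using (tr∈𝔽₂)
  open Enumeration enum-bij using (any?)
  open ≡-Reasoning

  tracePoly : ℕ → Poly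
  tracePoly zero    = []
  tracePoly (suc i) = monomial (2 ℕ.^ i) +ᴾ tracePoly i

  eval-tracePoly : ∀ i x → eval (tracePoly i) x ≡ trAux i x
  eval-tracePoly zero    x = refl
  eval-tracePoly (suc i) x = trans (eval-+ᴾ (monomial (2 ℕ.^ i)) (tracePoly i) x)
    (cong₂ _+_ (trans (eval-monomial (2 ℕ.^ i) x) (sym (sqIter≡^ i x))) (eval-tracePoly i x))

  length-tracePoly : ∀ i → length (tracePoly i) ≤ 2 ℕ.^ i
  length-tracePoly zero    = z≤n
  length-tracePoly (suc i) = length-+ᴾ (monomial (2 ℕ.^ i)) (tracePoly i)
    (ℕP.≤-trans (ℕP.≤-reflexive (length-monomial (2 ℕ.^ i))) 2^i<2^[1+i])
    (ℕP.≤-trans (length-tracePoly i) (ℕP.<⇒≤ 2^i<2^[1+i]))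
    where
    2^i<2^[1+i] : 2 ℕ.^ i ℕ.< 2 ℕ.^ suc i
    2^i<2^[1+i] = ℕP.^-monoʳ-< 2 (s≤s (s≤s z≤n)) (ℕP.n<1+n i)

  coeff₁-tracePoly : ∀ i → i ≥ 1 → coeff (tracePoly i) 1 ≡ 1#
  coeff₁-tracePoly (suc zero)    _ = refl
  coeff₁-tracePoly (suc (suc i)) _ = begin
    coeff (monomial (2 ℕ.^ suc i) +ᴾ tracePoly (suc i)) 1             ≡⟨ coeff-+ᴾ (monomial (2 ℕ.^ suc i)) _ 1 ⟩
    coeff (monomial (2 ℕ.^ suc i)) 1 + coeff (tracePoly (suc i)) 1    ≡⟨ cong₂ _+_ (coeff-monomial-≢ 2^[1+i]≢1)
                                                                                   (coeff₁-tracePoly (suc i) (s≤s z≤n)) ⟩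
    0# + 1#                                                            ≡⟨ +-identityˡ 1# ⟩
    1#                                                                 ∎
    where
    2^[1+i]≢1 : 2 ℕ.^ suc i ≢ 1
    2^[1+i]≢1 eq with ℕP.m*n≡1⇒m≡1 2 (2 ℕ.^ i) eq
    ... | ()

  -- tr is a nonzero polynomial of degree 2^(m-1) < q, so it cannot vanish on all of F.
  tr-nonvanishing : m ≥ 1 → ∃ λ d → tr d ≡ 1#
  tr-nonvanishing m≥1 with any? (λ x → tr x ≟ 1#)
  ... | yes found = found
  ... | no  none  = ⊥-elim (1≢0 (begin
    1#                      ≡⟨ sym (coeff₁-tracePoly m m≥1) ⟩
    coeff (tracePoly m) 1   ≡⟨ coeff-IsZero (tracePoly m) 1 tracePoly-IsZero ⟩
    0#                      ∎))
    where
    tr≡0 : ∀ x → tr x ≡ 0#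
    tr≡0 x with tr∈𝔽₂ x
    ... | inj₁ tr≡0 = tr≡0
    ... | inj₂ tr≡1 = ⊥-elim (none (x , tr≡1))
    tracePoly-IsZero : IsZero (tracePoly m)
    tracePoly-IsZero = roots⇒IsZero enum (proj₁ enum-bij) (tracePoly m)
                         (λ i → trans (eval-tracePoly m (enum i)) (tr≡0 (enum i))) (length-tracePoly m)

module Characters {m : ℕ} (F : GF2 m) (m≥1 : m ≥ 1) where
  open CharacteristicTwo F
  open TraceValues F using (tr∈𝔽₂)
  open TraceNondegeneracy F using (tr-nonvanishing)
  open IntegerSummation
  open Over enum-bij
  open ≡-Reasoning

  ΣF≡∑ : ∀ g → ΣF g ≡ ∑ g
  ΣF≡∑ g = sumFin≡sum q (g ∘ enum)

  χ-0 : χ 0# ≡ + 1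
  χ-0 with 0# ≟ 0#
  ... | yes _   = refl
  ... | no  0≢0 = ⊥-elim (0≢0 refl)

  χ-1 : χ 1# ≡ - + 1
  χ-1 with 1# ≟ 0#
  ... | yes 1≡0 = ⊥-elim (1≢0 1≡0)
  ... | no  _   = refl

  χ-flip : ∀ {t} → t ≡ 0# ⊎ t ≡ 1# → χ (t + 1#) ≡ - χ t
  χ-flip (inj₁ refl) = trans (cong χ (+-identityˡ 1#)) (trans χ-1 (cong -_ (sym χ-0)))
  χ-flip (inj₂ refl) = trans (cong χ (char2 1#)) (trans χ-0 (cong -_ (sym χ-1)))

  charSum : Carrier → ℤ
  charSum c = ∑ (λ x → χ (tr (c * x)))

  charSum-0 : charSum 0# ≡ + q
  charSum-0 = begin
    ∑ (λ x → χ (tr (0# * x)))   ≡⟨ ∑-cong (λ x → trans (cong (χ ∘ tr) (zeroˡ x)) (trans (cong χ tr-0) χ-0)) ⟩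
    ∑ (λ _ → + 1)               ≡⟨ ∑-const (+ 1) ⟩
    q · + 1                     ≡⟨ ·-+1 q ⟩
    + q                         ∎

  -- Translating by e with tr (c * e) ≡ 1 flips the sign of every term.
  charSum-≢0 : ∀ {c} → c ≢ 0# → charSum c ≡ + 0
  charSum-≢0 {c} c≢0 = i≡-i⇒i≡0 (begin
    ∑ g                   ≡⟨ sym (∑-reindex g (_+ e) +e-injective) ⟩
    ∑ (λ x → g (x + e))   ≡⟨ ∑-cong flip ⟩
    ∑ (λ x → - g x)       ≡⟨ sum-neg (g ∘ enum) ⟩
    - ∑ g                 ∎)
    where
    d = proj₁ (tr-nonvanishing m≥1)
    e = proj₁ (divide c≢0 d)
    g : Carrier → ℤ
    g x = χ (tr (c * x))
    +e-injective : Injective _≡_ _≡_ (_+ e)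
    +e-injective {x} {y} eq = trans (x+y≡z⇒x≡z+y eq) (cancel-twiceʳ y e)
    flip : ∀ x → g (x + e) ≡ - g x
    flip x = begin
      χ (tr (c * (x + e)))          ≡⟨ cong χ (trans (cong tr (distribˡ c x e)) (tr-+ (c * x) (c * e))) ⟩
      χ (tr (c * x) + tr (c * e))   ≡⟨ cong (λ y → χ (tr (c * x) + tr y)) (proj₂ (divide c≢0 d)) ⟩
      χ (tr (c * x) + tr d)         ≡⟨ cong (λ t → χ (tr (c * x) + t)) (proj₂ (tr-nonvanishing m≥1)) ⟩
      χ (tr (c * x) + 1#)           ≡⟨ χ-flip (tr∈𝔽₂ (c * x)) ⟩
      - g x                         ∎

module Transpose {m : ℕ} (F : GF2 m) (m≥1 : m ≥ 1)
    {_∘_ _⋆_ : GF2.Carrier F → GF2.Carrier F → GF2.Carrier F}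
    (isPresemifield : GF2.IsPresemifield F _∘_) (isTranspose : GF2.IsTranspose F _∘_ _⋆_)
    (⋆-comm : ∀ x z → x ⋆ z ≡ z ⋆ x) where
  open CharacteristicTwo F
  open TraceNondegeneracy F using (tr-nonvanishing)
  open IsPresemifield isPresemifield using (closed; divʳ) renaming (distribˡ to ∘-distribˡ)
  open ≡-Reasoning

  private
    d : Carrier
    d = proj₁ (tr-nonvanishing m≥1)
    tr-d : tr d ≡ 1#
    tr-d = proj₂ (tr-nonvanishing m≥1)
    d≢0 : d ≢ 0#
    d≢0 d≡0 = 1≢0 (trans (sym tr-d) (trans (cong tr d≡0) tr-0))

  tr-nondegenerate : ∀ {u v} → (∀ w → tr (u * w) ≡ tr (v * w)) → u ≡ v
  tr-nondegenerate {u} {v} agree with (u + v) ≟ 0#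
  ... | yes u+v≡0 = x+y≡0⇒x≡y u+v≡0
  ... | no  u+v≢0 = let (e , [u+v]e≡d) = divide u+v≢0 d in ⊥-elim (1≢0 (begin
    1#                      ≡⟨ sym tr-d ⟩
    tr d                    ≡⟨ cong tr (sym [u+v]e≡d) ⟩
    tr ((u + v) * e)        ≡⟨ trans (cong tr (distribʳ e u v)) (tr-+ (u * e) (v * e)) ⟩
    tr (u * e) + tr (v * e) ≡⟨ x≡y⇒x+y≡0 (agree e) ⟩
    0#                      ∎))

  ⋆-distribʳ : ∀ x y z → (x + y) ⋆ z ≡ x ⋆ z + y ⋆ z
  ⋆-distribʳ x y z = tr-nondegenerate λ w → begin
    tr (((x + y) ⋆ z) * w)                  ≡⟨ isTranspose (x + y) w z ⟩
    tr ((x + y) * (w ∘ z))                  ≡⟨ trans (cong tr (distribʳ (w ∘ z) x y)) (tr-+ _ _) ⟩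
    tr (x * (w ∘ z)) + tr (y * (w ∘ z))     ≡⟨ sym (cong₂ _+_ (isTranspose x w z) (isTranspose y w z)) ⟩
    tr ((x ⋆ z) * w) + tr ((y ⋆ z) * w)     ≡⟨ sym (trans (cong tr (distribʳ w (x ⋆ z) (y ⋆ z))) (tr-+ _ _)) ⟩
    tr ((x ⋆ z + y ⋆ z) * w)                ∎

  ⋆-distribˡ : ∀ z x y → z ⋆ (x + y) ≡ z ⋆ x + z ⋆ y
  ⋆-distribˡ z x y = trans (⋆-comm z (x + y)) (trans (⋆-distribʳ x y z) (cong₂ _+_ (⋆-comm x z) (⋆-comm y z)))

  ⋆-zeroˡ : ∀ z → 0# ⋆ z ≡ 0#
  ⋆-zeroˡ z = tr-nondegenerate λ w → begin
    tr ((0# ⋆ z) * w)   ≡⟨ isTranspose 0# w z ⟩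
    tr (0# * (w ∘ z))   ≡⟨ cong tr (trans (zeroˡ (w ∘ z)) (sym (zeroˡ w))) ⟩
    tr (0# * w)         ∎

  -- Choose e with tr (x * e) ≡ 1 and w with w ∘ z ≡ e; then tr ((x ⋆ z) * w) ≡ 1.
  ⋆-zero-divisor : ∀ {x z} → x ⋆ z ≡ 0# → x ≡ 0# ⊎ z ≡ 0#
  ⋆-zero-divisor {x} {z} x⋆z≡0 with x ≟ 0# | z ≟ 0#
  ... | yes x≡0 | _       = inj₁ x≡0
  ... | no  _   | yes z≡0 = inj₂ z≡0
  ... | no  x≢0 | no  z≢0 = ⊥-elim (1≢0 (begin
    1#                  ≡⟨ sym tr-d ⟩
    tr d                ≡⟨ cong tr (sym xe≡d) ⟩
    tr (x * e)          ≡⟨ cong (λ y → tr (x * y)) (sym wz≡e) ⟩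
    tr (x * (w ∘ z))    ≡⟨ sym (isTranspose x w z) ⟩
    tr ((x ⋆ z) * w)    ≡⟨ cong (λ y → tr (y * w)) x⋆z≡0 ⟩
    tr (0# * w)         ≡⟨ trans (cong tr (zeroˡ w)) tr-0 ⟩
    0#                  ∎))
    where
    e = proj₁ (divide x≢0 d)
    xe≡d = proj₂ (divide x≢0 d)
    e≢0 : e ≢ 0#
    e≢0 e≡0 = d≢0 (trans (sym xe≡d) (trans (cong (x *_) e≡0) (zeroʳ x)))
    w = proj₁ (divʳ z e z≢0 e≢0)
    wz≡e = proj₁ (proj₂ (proj₂ (divʳ z e z≢0 e≢0)))

  G : Carrier → Carrier
  G z = z ⋆ z

  G-+ : ∀ z w → G (z + w) ≡ G z + G w
  G-+ z w = begin
    (z + w) ⋆ (z + w)                      ≡⟨ ⋆-distribʳ z w (z + w) ⟩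
    z ⋆ (z + w) + w ⋆ (z + w)              ≡⟨ cong₂ _+_ (⋆-distribˡ z z w) (⋆-distribˡ w z w) ⟩
    (z ⋆ z + z ⋆ w) + (w ⋆ z + w ⋆ w)      ≡⟨ cong (λ y → (z ⋆ z + z ⋆ w) + (y + w ⋆ w)) (⋆-comm w z) ⟩
    (z ⋆ z + z ⋆ w) + (z ⋆ w + w ⋆ w)      ≡⟨ +-assoc (z ⋆ z) _ _ ⟩
    z ⋆ z + (z ⋆ w + (z ⋆ w + w ⋆ w))      ≡⟨ +-congˡ (cancel-twiceˡ (z ⋆ w) (w ⋆ w)) ⟩
    z ⋆ z + w ⋆ w                          ∎

  G-injective : Injective _≡_ _≡_ G
  G-injective {z} {w} Gz≡Gw = x+y≡0⇒x≡y (Sum.reduce (⋆-zero-divisor (trans (G-+ z w) (x≡y⇒x+y≡0 Gz≡Gw))))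

  G-surjective : ∀ a → ∃ λ z → G z ≡ a
  G-surjective = Enumeration.injective⇒surjective enum-bij G G-injective

  ∘-injective : ∀ {x} → x ≢ 0# → Injective _≡_ _≡_ (x ∘_)
  ∘-injective {x} x≢0 {z} {z′} eq with (z + z′) ≟ 0#
  ... | yes z+z′≡0 = x+y≡0⇒x≡y z+z′≡0
  ... | no  z+z′≢0 = ⊥-elim (closed x (z + z′) x≢0 z+z′≢0 (trans (∘-distribˡ x z z′) (x≡y⇒x+y≡0 eq)))

module LineOval {m : ℕ} (F : GF2 m) (m≥1 : m ≥ 1)
    {_∘_ _⋆_ : GF2.Carrier F → GF2.Carrier F → GF2.Carrier F}
    (isPresemifield : GF2.IsPresemifield F _∘_) (isTranspose : GF2.IsTranspose F _∘_ _⋆_)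
    (⋆-comm : ∀ x z → x ⋆ z ≡ z ⋆ x) where
  open CharacteristicTwo F
  open Transpose F m≥1 isPresemifield isTranspose ⋆-comm
  open ≡-Reasoning

  meet-abscissa : ∀ {z w x y} → z ≢ w → y ≡ x ⋆ z + G z → y ≡ x ⋆ w + G w → x ≡ z + w
  meet-abscissa {z} {w} {x} z≢w on-z on-w with ⋆-zero-divisor [x+u]⋆u≡0
    where
    u = z + w
    x⋆u≡Gu : x ⋆ u ≡ G u
    x⋆u≡Gu = begin
      x ⋆ (z + w)        ≡⟨ ⋆-distribˡ x z w ⟩
      x ⋆ z + x ⋆ w      ≡⟨ x+y≡0⇒x≡y (trans (+-interchange _ _ _ _) (x≡y⇒x+y≡0 (trans (sym on-z) on-w))) ⟩
      G z + G w          ≡⟨ sym (G-+ z w) ⟩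
      G u                ∎
    [x+u]⋆u≡0 : (x + u) ⋆ u ≡ 0#
    [x+u]⋆u≡0 = trans (⋆-distribʳ x u u) (x≡y⇒x+y≡0 x⋆u≡Gu)
  ... | inj₁ x+u≡0 = x+y≡0⇒x≡y x+u≡0
  ... | inj₂ u≡0   = ⊥-elim (z≢w (x+y≡0⇒x≡y u≡0))

  meet-ordinate : ∀ z w → (z + w) ⋆ z + G z ≡ w ⋆ z
  meet-ordinate z w = trans (+-congʳ (trans (⋆-distribʳ z w z) (+-comm (G z) (w ⋆ z)))) (cancel-twiceʳ (w ⋆ z) (G z))

  O : Maybe Carrier → Line
  O = ovalO _⋆_

  isLineOval : IsLineOval _⋆_ O
  isLineOval = distinct , intersect , no-three-concurrent
    where
    just-≢ : ∀ {z w : Carrier} → just z ≢ just w → z ≢ w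
    just-≢ i≢j z≡w = i≢j (cong just z≡w)

    distinct : ∀ i j → i ≢ j →
               ¬ (∀ p → (On _⋆_ (O i) p → On _⋆_ (O j) p) × (On _⋆_ (O j) p → On _⋆_ (O i) p))
    distinct nothing  nothing  i≢j _    = i≢j refl
    distinct nothing  (just z) _   same = 1≢0 (proj₂ (same (1# , 1# ⋆ z + G z)) refl)
    distinct (just z) nothing  _   same = 1≢0 (proj₁ (same (1# , 1# ⋆ z + G z)) refl)
    distinct (just z) (just w) i≢j same =
      i≢j (cong just (x+y≡0⇒x≡y (sym (meet-abscissa (just-≢ i≢j) refl (proj₁ (same (0# , 0# ⋆ z + G z)) refl)))))

    intersect : ∀ i j → i ≢ j → ∃ λ p → On _⋆_ (O i) p × On _⋆_ (O j) p
    intersect nothing  nothing  i≢j = ⊥-elim (i≢j refl)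
    intersect nothing  (just z) _   = (0# , 0# ⋆ z + G z) , refl , refl
    intersect (just z) nothing  _   = (0# , 0# ⋆ z + G z) , refl , refl
    intersect (just z) (just w) _   = (z + w , w ⋆ z) , sym (meet-ordinate z w) ,
      sym (trans (cong (λ x → x ⋆ w + G w) (+-comm z w)) (trans (meet-ordinate w z) (⋆-comm z w)))

    not-on-axis : ∀ {z w x y} → z ≢ w → x ≡ 0# → y ≡ x ⋆ z + G z → y ≡ x ⋆ w + G w → ⊥
    not-on-axis z≢w x≡0 on-z on-w = z≢w (x+y≡0⇒x≡y (trans (sym (meet-abscissa z≢w on-z on-w)) x≡0))

    no-three-concurrent : ∀ i j k → i ≢ j → j ≢ k → i ≢ k →
                          ¬ (∃ λ p → On _⋆_ (O i) p × On _⋆_ (O j) p × On _⋆_ (O k) p)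
    no-three-concurrent nothing  nothing  _        i≢j _   _   _ = i≢j refl
    no-three-concurrent nothing  (just _) nothing  _   _   i≢k _ = i≢k refl
    no-three-concurrent (just _) nothing  nothing  _   j≢k _   _ = j≢k refl
    no-three-concurrent nothing  (just _) (just _) _   j≢k _   (_ , on-i , on-j , on-k) =
      not-on-axis (just-≢ j≢k) on-i on-j on-k
    no-three-concurrent (just _) nothing  (just _) _   _   i≢k (_ , on-i , on-j , on-k) =
      not-on-axis (just-≢ i≢k) on-j on-i on-k
    no-three-concurrent (just _) (just _) nothing  i≢j _   _   (_ , on-i , on-j , on-k) =
      not-on-axis (just-≢ i≢j) on-k on-i on-j
    no-three-concurrent (just z) (just _) (just _) i≢j j≢k i≢k (_ , on-i , on-j , on-k) =
      j≢k (cong just (+-cancelˡ z (trans (sym (meet-abscissa (just-≢ i≢j) on-i on-j))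
                                         (meet-abscissa (just-≢ i≢k) on-i on-k))))

module WalshSpectrum {m : ℕ} (F : GF2 m) (m≥1 : m ≥ 1)
    {_∘_ _⋆_ : GF2.Carrier F → GF2.Carrier F → GF2.Carrier F}
    (isPresemifield : GF2.IsPresemifield F _∘_) (isTranspose : GF2.IsTranspose F _∘_ _⋆_)
    (⋆-comm : ∀ x z → x ⋆ z ≡ z ⋆ x)
    {f : GF2.Carrier F → GF2.Carrier F → GF2.Carrier F}
    (f-0 : ∀ y → f (GF2.0# F) y ≡ GF2.0# F)
    (f-def : ∀ x y z → x ≢ GF2.0# F → x ∘ z ≡ y → f x y ≡ GF2.tr F (GF2._*_ F (z ⋆ z) x)) where
  open CharacteristicTwo F
  open Transpose F m≥1 isPresemifield isTranspose ⋆-comm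
  open Characters F m≥1
  open IntegerSummation
  open Over enum-bij
  open Enumeration enum-bij using (any?)
  open ≡-Reasoning

  module _ (a b : Carrier) where

    gap : Carrier → Carrier
    gap z = (b ⋆ z + G z) + a

    gap≡0⇒on : ∀ {z} → gap z ≡ 0# → a ≡ b ⋆ z + G z
    gap≡0⇒on gap≡0 = sym (x+y≡0⇒x≡y gap≡0)

    on⇒gap≡0 : ∀ {z} → a ≡ b ⋆ z + G z → gap z ≡ 0#
    on⇒gap≡0 on = x≡y⇒x+y≡0 (sym on)

    walsh-term : ∀ {x} → x ≢ 0# → ∀ z → χ (f x (x ∘ z) + tr (a * x + b * (x ∘ z))) ≡ χ (tr (gap z * x))
    walsh-term {x} x≢0 z = cong χ (begin
      f x (x ∘ z) + tr (a * x + b * (x ∘ z))            ≡⟨ cong₂ _+_ (f-def x (x ∘ z) z x≢0 refl) (tr-+ (a * x) _) ⟩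
      tr (G z * x) + (tr (a * x) + tr (b * (x ∘ z)))    ≡⟨ +-congˡ (+-congˡ (sym (isTranspose b x z))) ⟩
      tr (G z * x) + (tr (a * x) + tr ((b ⋆ z) * x))    ≡⟨ x+yz≡zx+y _ _ _ ⟩
      (tr ((b ⋆ z) * x) + tr (G z * x)) + tr (a * x)    ≡⟨ sym (trans (tr-+ _ _) (+-congʳ (tr-+ _ _))) ⟩
      tr (((b ⋆ z) * x + G z * x) + a * x)              ≡⟨ cong tr (+-congʳ (distribʳ x (b ⋆ z) (G z))) ⟨
      tr ((b ⋆ z + G z) * x + a * x)                    ≡⟨ cong tr (distribʳ x _ a) ⟨
      tr (gap z * x)                                    ∎)

    -- Substituting y = x ∘ z in the rows x ≢ 0 and swapping the order of summation.
    walsh-identity : Walsh f a b +ℤ + q ≡ ∑ (λ z → charSum (gap z)) +ℤ charSum b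
    walsh-identity = begin
      Walsh f a b +ℤ + q                     ≡⟨ cong₂ _+ℤ_ walsh≡∑row (sym K-0) ⟩
      ∑ row +ℤ K 0#                          ≡⟨ ∑-agree-except row K 0# row≡K ⟩
      ∑ K +ℤ row 0#                          ≡⟨ cong₂ _+ℤ_ (∑-swap (λ x z → χ (tr (gap z * x)))) row-0 ⟩
      ∑ (λ z → charSum (gap z)) +ℤ charSum b ∎
      where
      entry : Carrier → Carrier → ℤ
      entry x y = χ (f x y + tr (a * x + b * y))
      row : Carrier → ℤ
      row x = ∑ (entry x)
      K : Carrier → ℤ
      K x = ∑ (λ z → χ (tr (gap z * x)))
      K-0 : K 0# ≡ + q
      K-0 = trans (∑-cong (λ z → cong (λ t → χ (tr t)) (trans (zeroʳ (gap z)) (sym (zeroˡ z))))) charSum-0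
      row≡K : ∀ x → x ≢ 0# → row x ≡ K x
      row≡K x x≢0 = trans (sym (∑-reindex (entry x) (x ∘_) (∘-injective x≢0))) (∑-cong (walsh-term x≢0))
      walsh≡∑row : Walsh f a b ≡ ∑ row
      walsh≡∑row = trans (ΣF≡∑ (λ x → ΣF (entry x))) (∑-cong (λ x → ΣF≡∑ (entry x)))
      row-0 : row 0# ≡ charSum b
      row-0 = ∑-cong λ y → cong χ (begin
        f 0# y + tr (a * 0# + b * y)   ≡⟨ cong₂ _+_ (f-0 y) (cong (λ t → tr (t + b * y)) (zeroʳ a)) ⟩
        0# + tr (0# + b * y)           ≡⟨ trans (+-identityˡ _) (cong tr (+-identityˡ _)) ⟩
        tr (b * y)                     ∎)

    gap-shift : ∀ z u → gap (z + u) ≡ gap z + (b + u) ⋆ u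
    gap-shift z u = begin
      (b ⋆ (z + u) + G (z + u)) + a              ≡⟨ +-congʳ (cong₂ _+_ (⋆-distribˡ b z u) (G-+ z u)) ⟩
      ((b ⋆ z + b ⋆ u) + (G z + G u)) + a        ≡⟨ +-congʳ (+-interchange _ _ _ _) ⟩
      ((b ⋆ z + G z) + (b ⋆ u + G u)) + a        ≡⟨ xy+z≡xz+y _ _ _ ⟩
      gap z + (b ⋆ u + u ⋆ u)                    ≡⟨ +-congˡ (sym (⋆-distribʳ b u u)) ⟩
      gap z + (b + u) ⋆ u                        ∎

    gap-roots : ∀ {z₀ z} → gap z₀ ≡ 0# → gap z ≡ 0# → z ≡ z₀ ⊎ z ≡ z₀ + b
    gap-roots {z₀} {z} gap-z₀ gap-z with ⋆-zero-divisor [b+u]⋆u≡0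
      where
      u = z₀ + z
      [b+u]⋆u≡0 : (b + u) ⋆ u ≡ 0#
      [b+u]⋆u≡0 = begin
        (b + u) ⋆ u             ≡⟨ sym (trans (+-congʳ gap-z₀) (+-identityˡ _)) ⟩
        gap z₀ + (b + u) ⋆ u    ≡⟨ sym (gap-shift z₀ u) ⟩
        gap (z₀ + u)            ≡⟨ cong gap (cancel-twiceˡ z₀ z) ⟩
        gap z                   ≡⟨ gap-z ⟩
        0#                      ∎
    ... | inj₁ b+u≡0 = inj₂ (trans (sym (cancel-twiceˡ z₀ z)) (+-congˡ (sym (x+y≡0⇒x≡y b+u≡0))))
    ... | inj₂ u≡0   = inj₁ (sym (x+y≡0⇒x≡y u≡0))

    gap-partner : ∀ {z₀} → gap z₀ ≡ 0# → gap (z₀ + b) ≡ 0#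
    gap-partner {z₀} gap-z₀ = trans (gap-shift z₀ b)
      (trans (cong₂ _+_ gap-z₀ (trans (cong (_⋆ b) (char2 b)) (⋆-zeroˡ b))) (+-identityˡ 0#))

    walsh-on-axis : b ≡ 0# → Walsh f a b ≡ + q
    walsh-on-axis refl = +ℤ-cancelʳ (+ q) _ _ (trans walsh-identity (cong₂ _+ℤ_ single-root charSum-0))
      where
      z₀ = proj₁ (G-surjective a)
      Gz₀≡a = proj₂ (G-surjective a)
      0⋆z+Gz≡Gz : ∀ z → 0# ⋆ z + G z ≡ G z
      0⋆z+Gz≡Gz z = trans (+-congʳ (⋆-zeroˡ z)) (+-identityˡ (G z))
      root-unique : ∀ {z} → gap z ≡ 0# → z ≡ z₀
      root-unique {z} gap-z = G-injective (begin
        G z              ≡⟨ 0⋆z+Gz≡Gz z ⟨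
        0# ⋆ z + G z     ≡⟨ gap≡0⇒on gap-z ⟨
        a                ≡⟨ Gz₀≡a ⟨
        G z₀             ∎)
      single-root : ∑ (λ z → charSum (gap z)) ≡ + q
      single-root = begin
        ∑ (λ z → charSum (gap z))   ≡⟨ ∑-single _ z₀ (λ z z≢z₀ → charSum-≢0 (z≢z₀ ∘′ root-unique)) ⟩
        charSum (gap z₀)            ≡⟨ cong charSum (on⇒gap≡0 (trans (sym Gz₀≡a) (sym (0⋆z+Gz≡Gz z₀)))) ⟩
        charSum 0#                  ≡⟨ charSum-0 ⟩
        + q                         ∎

    walsh-two-roots : ∀ {z₀} → b ≢ 0# → gap z₀ ≡ 0# → Walsh f a b ≡ + q
    walsh-two-roots {z₀} b≢0 gap-z₀ = +ℤ-cancelʳ (+ q) _ _ (begin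
      Walsh f a b +ℤ + q                          ≡⟨ walsh-identity ⟩
      ∑ (λ z → charSum (gap z)) +ℤ charSum b      ≡⟨ cong₂ _+ℤ_ two-roots (charSum-≢0 b≢0) ⟩
      (charSum 0# +ℤ charSum 0#) +ℤ + 0           ≡⟨ trans (ℤP.+-identityʳ _) (cong₂ _+ℤ_ charSum-0 charSum-0) ⟩
      + q +ℤ + q                                  ∎)
      where
      z₀≢z₀+b : z₀ ≢ z₀ + b
      z₀≢z₀+b eq = b≢0 (sym (+-cancelˡ z₀ (trans (+-identityʳ z₀) eq)))
      two-roots : ∑ (λ z → charSum (gap z)) ≡ charSum 0# +ℤ charSum 0#
      two-roots = trans (∑-pair _ z₀≢z₀+b (λ z z≢z₀ z≢z₀+b → charSum-≢0 λ gap-z →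
                           [ z≢z₀ , z≢z₀+b ] (gap-roots gap-z₀ gap-z)))
                        (cong₂ _+ℤ_ (cong charSum gap-z₀) (cong charSum (gap-partner gap-z₀)))

    walsh-no-root : b ≢ 0# → (∀ z → gap z ≢ 0#) → Walsh f a b ≡ - + q
    walsh-no-root b≢0 no-root = +ℤ-cancelʳ (+ q) _ _ (begin
      Walsh f a b +ℤ + q                          ≡⟨ walsh-identity ⟩
      ∑ (λ z → charSum (gap z)) +ℤ charSum b      ≡⟨ cong₂ _+ℤ_ (∑-zero (λ z → charSum (gap z)) (λ z → charSum-≢0 (no-root z))) (charSum-≢0 b≢0) ⟩
      + 0                                         ≡⟨ sym (ℤP.+-inverseˡ (+ q)) ⟩
      - + q +ℤ + q                                ∎)

    walsh-value : (InE _⋆_ (b , a) × Walsh f a b ≡ + q) ⊎ (¬ InE _⋆_ (b , a) × Walsh f a b ≡ - + q)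
    walsh-value with b ≟ 0# | any? (λ z → gap z ≟ 0#)
    ... | yes b≡0 | _                  = inj₁ ((nothing , b≡0) , walsh-on-axis b≡0)
    ... | no  b≢0 | yes (z₀ , gap-z₀)  = inj₁ ((just z₀ , gap≡0⇒on gap-z₀) , walsh-two-roots b≢0 gap-z₀)
    ... | no  b≢0 | no  no-root        = inj₂ (∉E , walsh-no-root b≢0 (λ z gap-z → no-root (z , gap-z)))
      where
      ∉E : ¬ InE _⋆_ (b , a)
      ∉E (nothing , b≡0) = b≢0 b≡0
      ∉E (just z  , on)  = no-root (z , on⇒gap≡0 on)

corollary4p10 : (m : ℕ) → m ≥ 1 → (F : GF2 m) →
    let open GF2 F in
    (_∘_ : Carrier → Carrier → Carrier) → IsPresemifield _∘_ →
    (_⋆_ : Carrier → Carrier → Carrier) → IsTranspose _∘_ _⋆_ →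
    (∀ x z → x ⋆ z ≡ z ⋆ x) →
    (f : Carrier → Carrier → Carrier) →
    (∀ y → f 0# y ≡ 0#) →
    (∀ x y z → x ≢ 0# → x ∘ z ≡ y → f x y ≡ tr ((z ⋆ z) * x)) →
    IsBent f
    × IsLineOval _⋆_ (ovalO _⋆_)
    × (∀ a b → (InE _⋆_ (b , a) → Walsh f a b ≡ + q)
             × (¬ InE _⋆_ (b , a) → Walsh f a b ≡ - (+ q)))
corollary4p10 m m≥1 F _∘_ isPresemifield _⋆_ isTranspose ⋆-comm f f-0 f-def = bent , isLineOval , dual
  where
  open GF2 F
  open LineOval F m≥1 isPresemifield isTranspose ⋆-comm using (isLineOval)
  open WalshSpectrum F m≥1 isPresemifield isTranspose ⋆-comm f-0 f-def using (walsh-value)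

  bent : IsBent f
  bent a b = Sum.map proj₂ proj₂ (walsh-value a b)

  dual : ∀ a b → (InE _⋆_ (b , a) → Walsh f a b ≡ + q) × (¬ InE _⋆_ (b , a) → Walsh f a b ≡ - (+ q))
  dual a b with walsh-value a b
  ... | inj₁ (∈E , W≡q)  = (λ _ → W≡q) , (λ ∉E → ⊥-elim (∉E ∈E))
  ... | inj₂ (∉E , W≡-q) = (λ ∈E → ⊥-elim (∉E ∈E)) , (λ _ → W≡-q)
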